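{- Let $q\equiv1\pmod{12}$, and suppose that $-1/2$ is a cube in $\mathbb{F}_q$ and $-1/3$ is a fourth power in $\mathbb{F}_q$. Let $L$ be the line through $\mathrm{P}(1,0,0,1)$ and $\mathrm{P}(0,0,1,0)$, and $\ell_{ -1/3}$ the line through $\mathrm{P}(0,-1/3,0,1)$ and $\mathrm{P}(1,0,1,0)$. Then $-1/3$ is a square in $\mathbb{F}_q$, and $L$ and $\ell_{ -1/3}$ belong to the same orbit of $G_q$.
   Context: $\mathrm{P}(x_0,x_1,x_2,x_3)$ denotes a point of $\mathrm{PG}(3,q)$ in homogeneous coordinates. The twisted cubic is $\mathcal{C}=\{P(t): t\in\mathbb{F}_q\cup\{\infty\}\}$, $P(t)=\mathrm{P}(t^3,t^2,t,1)$ for $t\in\mathbb{F}_q$, $P(\infty)=\mathrm{P}(1,0,0,0)$. $G_q$ is the group of projectivities of $\mathrm{PG}(3,q)$ mapping $\mathcal{C}$ onto itself; for $q\ge5$ its elements are exactly the maps $\mathrm{P}(x)\mapsto\mathrm{P}(xM)$ ($x$ a row vector) with $M=\begin{pmatrix} a^3&a^2c&ac^2&c^3\\ 3a^2b&a^2d+2abc&bc^2+2acd&3c^2d\\ 3ab^2&b^2c+2abd&ad^2+2bcd&3cd^2\\ b^3&b^2d&bd^2&d^3\end{pmatrix}$, $a,b,c,d\in\mathbb{F}_q$, $ad-bc\ne0$. -}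

module Defs where

open import Level using (0ℓ)
open import Algebra.Bundles using (CommutativeRing)
open import Data.Nat using (ℕ)
open import Data.Fin using (Fin; zero; suc)
open import Data.Product using (∃; Σ; _×_; _,_)
open import Relation.Nullary using (¬_)
open import Relation.Binary.PropositionalEquality using (_≡_)
open import Function.Bundles using (_⇔_)

record FiniteField (q : ℕ) : Set₁ where
  field
    commRing : CommutativeRing 0ℓ 0ℓ
  open CommutativeRing commRing public hiding (ring)
  field
    1≉0            : ¬ (1# ≈ 0#)
    _⁻¹            : Carrier → Carrier
    inverseʳ       : ∀ x → ¬ (x ≈ 0#) → x * (x ⁻¹) ≈ 1#
    enum           : Fin q → Carrier
    enum-injective : ∀ i j → enum i ≈ enum j → i ≡ j
    enum-surjective : ∀ x → ∃ λ i → enum i ≈ x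

module Geometry {q : ℕ} (F : FiniteField q) where
  open FiniteField F hiding (zero)

  2# 3# : Carrier
  2# = 1# + 1#
  3# = 1# + 1# + 1#

  -- vectors of F_q^4 (homogeneous coordinates x0..x3) and 4×4 matrices
  Vec4 : Set
  Vec4 = Fin 4 → Carrier

  Mat4 : Set
  Mat4 = Fin 4 → Fin 4 → Carrier

  vec : Carrier → Carrier → Carrier → Carrier → Vec4
  vec x0 x1 x2 x3 zero = x0
  vec x0 x1 x2 x3 (suc zero) = x1
  vec x0 x1 x2 x3 (suc (suc zero)) = x2
  vec x0 x1 x2 x3 (suc (suc (suc zero))) = x3

  _·M_ : Vec4 → Mat4 → Vec4
  (x ·M M) j = x zero * M zero j + x (suc zero) * M (suc zero) j
             + x (suc (suc zero)) * M (suc (suc zero)) j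
             + x (suc (suc (suc zero))) * M (suc (suc (suc zero))) j

  -- x represents a point of PG(3,q)
  Nonzero : Vec4 → Set
  Nonzero x = ¬ (∀ i → x i ≈ 0#)

  OnLine : Vec4 → Vec4 → Vec4 → Set
  OnLine A B x = ∃ λ λ₁ → ∃ λ μ → ∀ i → x i ≈ λ₁ * A i + μ * B i

  -- the matrix of the element of G_q given by (a,b,c,d)

  cubicMat : Carrier → Carrier → Carrier → Carrier → Mat4
  cubicMat a b c d zero =
    vec (a * a * a) (a * a * c) (a * c * c) (c * c * c)
  cubicMat a b c d (suc zero) =
    vec (3# * (a * a * b)) (a * a * d + 2# * (a * b * c))
        (b * c * c + 2# * (a * c * d)) (3# * (c * c * d))
  cubicMat a b c d (suc (suc zero)) =
    vec (3# * (a * b * b)) (b * b * c + 2# * (a * b * d))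
        (a * d * d + 2# * (b * c * d)) (3# * (c * d * d))
  cubicMat a b c d (suc (suc (suc zero))) =
    vec (b * b * b) (b * b * d) (b * d * d) (d * d * d)

  MapsLineOnto : Carrier → Carrier → Carrier → Carrier → Vec4 → Vec4 → Vec4 → Vec4 → Set
  MapsLineOnto a b c d A B C D =
    ∀ x → Nonzero x → (OnLine A B x ⇔ OnLine C D (x ·M cubicMat a b c d))

  SameOrbit : Vec4 → Vec4 → Vec4 → Vec4 → Set
  SameOrbit A B C D =
    ∃ λ a → ∃ λ b → ∃ λ c → ∃ λ d →
      ¬ (a * d - b * c ≈ 0#) × MapsLineOnto a b c d A B C D

module Submission where

-- G_q preserves, up to the factor (ad − bc)³, the alternating form ω of the null polarity of
-- the twisted cubic.  Both L and ℓ_{−1/3} are totally isotropic for ω (for ℓ this is exactly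
-- 3 · (1/3) = 1), and L is even cut out by ω(A, ·) and ω(B, ·) for its spanning points A, B.
-- So a projectivity of G_q maps L onto ℓ as soon as it maps A and B into ℓ: a point whose image
-- lies on ℓ pairs to zero with A and B.  With i² = −1, r³ = −2 and s⁴ = −3 (r and s are x⁻¹ and
-- −y⁻¹ for the given roots x of −1/2 and y of −1/3), the matrix with a = 2(1 − i),
-- b = r(1 − i)(1 − is²), c = −2s(1 − is²), d = 2rs does this; what remains are polynomial
-- identities modulo the three relations.  Finally q ≡ 1 (mod 12) excludes characteristic 2 and 3
-- (Lagrange for the additive subgroup generated by 1), and provides i: if −1 were not a square,
-- {x, −x, x⁻¹, −x⁻¹} would act freely on F ∖ {0, 1, −1}, whose size q − 3 is not divisible by 4.

open import Defs
open import Level using (0ℓ)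
open import Algebra.Bundles using (CommutativeRing)
open import Data.Nat as ℕ using (ℕ; zero; suc; _%_)
import Data.Nat.Properties as ℕ
open import Data.Nat.Divisibility using (_∣_; divides; _∣0; ∣-refl; ∣m∣n⇒∣m+n; n∣m⇒m%n≡0)
open import Data.Nat.DivMod using (m∣n⇒o%n%m≡o%m; [m+kn]%n≡m%n)
open import Data.Fin as Fin using (Fin)
open import Data.Fin.Patterns using (0F; 1F; 2F; 3F)
import Data.Fin.Properties as FinP
open import Data.List using (List; []; _∷_; length; filter; tabulate; allFin)
open import Data.List.Membership.Propositional using (_∈_)
open import Data.List.Membership.Propositional.Properties using (∈-filter⁻; ∈-filter⁺; ∈-tabulate⁺; ∈-tabulate⁻; ∈-allFin)
open import Data.List.Membership.Propositional.Properties.WithK using (unique∧set⇒bag)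
open import Data.List.Relation.Binary.BagAndSetEquality using (∼bag⇒↭)
open import Data.List.Relation.Binary.Permutation.Propositional.Properties using (↭-length)
open import Data.List.Relation.Binary.Subset.Propositional using (_⊆_)
open import Data.List.Relation.Unary.All as All using (All; []; _∷_)
open import Data.List.Relation.Unary.AllPairs using ([]; _∷_)
import Data.List.Relation.Unary.All.Properties as AllP
open import Data.List.Relation.Unary.Any using (here; there)
open import Data.List.Relation.Unary.Unique.Propositional using (Unique)
import Data.List.Relation.Unary.Unique.Propositional.Properties as UniqueP
import Data.List.Properties as ListP
open import Data.Product using (∃; _×_; _,_; proj₁; proj₂)
open import Function using (_∘_; id)
open import Data.Unit using (tt)
open import Data.Empty using (⊥-elim)
open import Function.Bundles using (mk⇔)
open import Relation.Binary using (DecidableEquality) renaming (Decidable to Decidable₂)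
open import Relation.Binary.PropositionalEquality as ≡ using (_≡_)
open import Relation.Nullary using (¬_; ¬?; _×-dec_; yes; no)
open import Relation.Nullary.Decidable using (map′)
open import Relation.Unary using (Pred; Decidable; U)
open import Relation.Unary.Properties using (∁?; U?)

module IntegerCoefficientSolver (R : CommutativeRing 0ℓ 0ℓ) where

  open import Data.Integer as ℤ using (ℤ; +_; -[1+_]; _⊖_; _◃_; sign; ∣_∣)
  import Data.Integer.Properties as ℤ
  open import Data.Sign as Sign using (Sign)
  open import Data.Maybe using (Maybe; just; nothing)
  open import Algebra.Solver.Ring.AlmostCommutativeRing
    using (_-Raw-AlmostCommutative⟶_; fromCommutativeRing)

  open CommutativeRing R
  open import Algebra.Properties.Ring ring
    using (-‿involutive; -0#≈0#; -‿distribˡ-*; -‿distribʳ-*)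
  open import Algebra.Properties.AbelianGroup +-abelianGroup using (⁻¹-∙-comm)
  open import Algebra.Properties.CommutativeSemigroup +-commutativeSemigroup using (interchange)
  open import Algebra.Properties.Semiring.Mult.TCOptimised semiring
    using (1+×; ×-homo-+; ×1-homo-*) renaming (_×_ to _×ₙ_)
  open import Relation.Binary.Reasoning.Setoid setoid

  -- On 0, 1, 2 and 3 this is definitionally 0#, 1#, 1# + 1# and 1# + 1# + 1#.
  ⟦_⟧ℤ : ℤ → Carrier
  ⟦ + n ⟧ℤ      = n ×ₙ 1#
  ⟦ -[1+ n ] ⟧ℤ = - (suc n ×ₙ 1#)

  [x+y]-[x+z]≈y-z : ∀ x y z → (x + y) - (x + z) ≈ y - z
  [x+y]-[x+z]≈y-z x y z = begin
    (x + y) + - (x + z)     ≈⟨ +-congˡ (⁻¹-∙-comm x z) ⟨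
    (x + y) + (- x + - z)   ≈⟨ interchange x y (- x) (- z) ⟩
    (x - x) + (y - z)       ≈⟨ +-congʳ (-‿inverseʳ x) ⟩
    0# + (y - z)            ≈⟨ +-identityˡ _ ⟩
    y - z                   ∎

  ⟦-⟧ℤ : ∀ z → ⟦ ℤ.- z ⟧ℤ ≈ - ⟦ z ⟧ℤ
  ⟦-⟧ℤ (+ zero)  = sym -0#≈0#
  ⟦-⟧ℤ (+ suc n) = refl
  ⟦-⟧ℤ -[1+ n ]  = sym (-‿involutive _)

  ⟦⊖⟧ℤ : ∀ m n → ⟦ m ⊖ n ⟧ℤ ≈ m ×ₙ 1# - n ×ₙ 1#
  ⟦⊖⟧ℤ m       zero    = sym (trans (+-congˡ -0#≈0#) (+-identityʳ _))
  ⟦⊖⟧ℤ zero    (suc n) = sym (+-identityˡ _)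
  ⟦⊖⟧ℤ (suc m) (suc n) = begin
    ⟦ suc m ⊖ suc n ⟧ℤ                ≡⟨ ≡.cong ⟦_⟧ℤ (ℤ.[1+m]⊖[1+n]≡m⊖n m n) ⟩
    ⟦ m ⊖ n ⟧ℤ                        ≈⟨ ⟦⊖⟧ℤ m n ⟩
    m ×ₙ 1# - n ×ₙ 1#                 ≈⟨ [x+y]-[x+z]≈y-z 1# _ _ ⟨
    (1# + m ×ₙ 1#) - (1# + n ×ₙ 1#)   ≈⟨ +-cong (1+× m 1#) (-‿cong (1+× n 1#)) ⟨
    suc m ×ₙ 1# - suc n ×ₙ 1#         ∎

  ⟦+⟧ℤ : ∀ a b → ⟦ a ℤ.+ b ⟧ℤ ≈ ⟦ a ⟧ℤ + ⟦ b ⟧ℤ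
  ⟦+⟧ℤ (+ m)    (+ n)    = ×-homo-+ 1# m n
  ⟦+⟧ℤ (+ m)    -[1+ n ] = ⟦⊖⟧ℤ m (suc n)
  ⟦+⟧ℤ -[1+ m ] (+ n)    = trans (⟦⊖⟧ℤ n (suc m)) (+-comm _ _)
  ⟦+⟧ℤ -[1+ m ] -[1+ n ] = begin
    - (suc (suc (m ℕ.+ n)) ×ₙ 1#)   ≡⟨ ≡.cong (λ k → - (k ×ₙ 1#)) (ℕ.+-suc (suc m) n) ⟨
    - ((suc m ℕ.+ suc n) ×ₙ 1#)     ≈⟨ -‿cong (×-homo-+ 1# (suc m) (suc n)) ⟩
    - (suc m ×ₙ 1# + suc n ×ₙ 1#)   ≈⟨ ⁻¹-∙-comm _ _ ⟨
    - (suc m ×ₙ 1#) - suc n ×ₙ 1#   ∎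

  signed : Sign → Carrier → Carrier
  signed Sign.+ x = x
  signed Sign.- x = - x

  signed-cong : ∀ s {x y} → x ≈ y → signed s x ≈ signed s y
  signed-cong Sign.+ = λ e → e
  signed-cong Sign.- = -‿cong

  signed-* : ∀ s t x y → signed (s Sign.* t) (x * y) ≈ signed s x * signed t y
  signed-* Sign.+ Sign.+ x y = refl
  signed-* Sign.+ Sign.- x y = -‿distribʳ-* x y
  signed-* Sign.- Sign.+ x y = -‿distribˡ-* x y
  signed-* Sign.- Sign.- x y = begin
    x * y          ≈⟨ -‿involutive _ ⟨
    - - (x * y)    ≈⟨ -‿cong (-‿distribʳ-* x y) ⟩
    - (x * - y)    ≈⟨ -‿distribˡ-* x (- y) ⟩
    - x * - y      ∎

  ⟦◃⟧ℤ : ∀ s n → ⟦ s ◃ n ⟧ℤ ≈ signed s (n ×ₙ 1#)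
  ⟦◃⟧ℤ Sign.+ zero    = refl
  ⟦◃⟧ℤ Sign.- zero    = sym -0#≈0#
  ⟦◃⟧ℤ Sign.+ (suc n) = refl
  ⟦◃⟧ℤ Sign.- (suc n) = refl

  ⟦*⟧ℤ : ∀ a b → ⟦ a ℤ.* b ⟧ℤ ≈ ⟦ a ⟧ℤ * ⟦ b ⟧ℤ
  ⟦*⟧ℤ a b = begin
    ⟦ sign a Sign.* sign b ◃ ∣ a ∣ ℕ.* ∣ b ∣ ⟧ℤ
      ≈⟨ ⟦◃⟧ℤ _ (∣ a ∣ ℕ.* ∣ b ∣) ⟩
    signed (sign a Sign.* sign b) ((∣ a ∣ ℕ.* ∣ b ∣) ×ₙ 1#)
      ≈⟨ signed-cong (sign a Sign.* sign b) (×1-homo-* ∣ a ∣ ∣ b ∣) ⟩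
    signed (sign a Sign.* sign b) (∣ a ∣ ×ₙ 1# * ∣ b ∣ ×ₙ 1#)
      ≈⟨ signed-* (sign a) (sign b) _ _ ⟩
    signed (sign a) (∣ a ∣ ×ₙ 1#) * signed (sign b) (∣ b ∣ ×ₙ 1#)
      ≈⟨ *-cong (sign-abs a) (sign-abs b) ⟨
    ⟦ a ⟧ℤ * ⟦ b ⟧ℤ
      ∎
    where
    sign-abs : ∀ z → ⟦ z ⟧ℤ ≈ signed (sign z) (∣ z ∣ ×ₙ 1#)
    sign-abs z = trans (reflexive (≡.cong ⟦_⟧ℤ (≡.sym (ℤ.◃-inverse z)))) (⟦◃⟧ℤ (sign z) ∣ z ∣)

  ℤ⟶R : ℤ.+-*-rawRing -Raw-AlmostCommutative⟶ fromCommutativeRing R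
  ℤ⟶R = record
    { ⟦_⟧ = ⟦_⟧ℤ ; +-homo = ⟦+⟧ℤ ; *-homo = ⟦*⟧ℤ ; -‿homo = ⟦-⟧ℤ
    ; 0-homo = refl ; 1-homo = refl }

  ⟦⟧ℤ-≟ : ∀ a b → Maybe (⟦ a ⟧ℤ ≈ ⟦ b ⟧ℤ)
  ⟦⟧ℤ-≟ a b with a ℤ.≟ b
  ... | yes ≡.refl = just refl
  ... | no _       = nothing

  open import Algebra.Solver.Ring ℤ.+-*-rawRing (fromCommutativeRing R) ℤ⟶R ⟦⟧ℤ-≟ public

  κ : ∀ {n} → ℕ → Polynomial n
  κ k = con (+ k)

  u≈0⇒p*u≈0 : ∀ {p u} → u ≈ 0# → p * u ≈ 0#
  u≈0⇒p*u≈0 {p} u≈0 = trans (*-congˡ u≈0) (zeroʳ p)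

  ≈-modulo₂ : ∀ {x y p₁ p₂ u₁ u₂} → x ≈ y + (p₁ * u₁ + p₂ * u₂) → u₁ ≈ 0# → u₂ ≈ 0# → x ≈ y
  ≈-modulo₂ {y = y} x≈ u₁≈0 u₂≈0 =
    trans x≈ (trans (+-congˡ (trans (+-cong (u≈0⇒p*u≈0 u₁≈0) (u≈0⇒p*u≈0 u₂≈0)) (+-identityʳ 0#)))
                    (+-identityʳ y))

  ≈-modulo₃ : ∀ {x y p₁ p₂ p₃ u₁ u₂ u₃} → x ≈ y + (p₁ * u₁ + p₂ * u₂ + p₃ * u₃) →
              u₁ ≈ 0# → u₂ ≈ 0# → u₃ ≈ 0# → x ≈ y
  ≈-modulo₃ {y = y} x≈ u₁≈0 u₂≈0 u₃≈0 =
    trans x≈ (trans (+-congˡ (trans (+-cong (+-cong (u≈0⇒p*u≈0 u₁≈0) (u≈0⇒p*u≈0 u₂≈0))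
                                            (u≈0⇒p*u≈0 u₃≈0))
                                    (trans (+-identityʳ _) (+-identityʳ 0#))))
                    (+-identityʳ y))

module OrbitCounting {A : Set} (_≟_ : DecidableEquality A) where

  open import Data.List.Membership.DecPropositional _≟_ using (_∈?_)

  length-filter-∁ : ∀ {P : Pred A 0ℓ} (P? : Decidable P) xs →
                    length (filter P? xs) ℕ.+ length (filter (∁? P?) xs) ≡ length xs
  length-filter-∁ P? []       = ≡.refl
  length-filter-∁ P? (x ∷ xs) with P? x
  ... | yes _ = ≡.cong suc (length-filter-∁ P? xs)
  ... | no  _ = ≡.trans (ℕ.+-suc _ _) (≡.cong suc (length-filter-∁ P? xs))

  Unique-⊆-⊇⇒length≡ : ∀ {xs ys : List A} → Unique xs → Unique ys → xs ⊆ ys → ys ⊆ xs →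
                        length xs ≡ length ys
  Unique-⊆-⊇⇒length≡ uxs uys xs⊆ys ys⊆xs =
    ↭-length (∼bag⇒↭ (unique∧set⇒bag uxs uys (mk⇔ xs⊆ys ys⊆xs)))

  OrbitClosed : (A → List A) → List A → Set
  OrbitClosed orbit xs = ∀ {x y} → x ∈ xs → y ∈ orbit x → y ∈ xs

  module _ (Ω : A → Set) (orbit : A → List A) (k : ℕ)
           (orbit-refl   : ∀ {x} → Ω x → x ∈ orbit x)
           (orbit-sym    : ∀ {x y} → Ω x → Ω y → y ∈ orbit x → x ∈ orbit y)
           (orbit-trans  : ∀ {x y z} → Ω x → Ω y → y ∈ orbit x → z ∈ orbit y → z ∈ orbit x)
           (orbit-unique : ∀ {x} → Ω x → Unique (orbit x))
           (orbit-length : ∀ {x} → Ω x → length (orbit x) ≡ k)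
           where

    orbits-divide : ∀ xs → Unique xs → All Ω xs → OrbitClosed orbit xs → k ∣ length xs
    orbits-divide xs = go (length xs) xs ℕ.≤-refl
      where
      go : ∀ n xs → length xs ℕ.≤ n → Unique xs → All Ω xs → OrbitClosed orbit xs → k ∣ length xs
      go _       []           _   _   _   _      = k ∣0
      go zero    (_ ∷ _)      ()
      go (suc n) xs@(x ∷ _) len uxs Ωxs closed =
        ≡.subst (k ∣_) (length-filter-∁ inOrbit? xs) (∣m∣n⇒∣m+n k∣inOrbit k∣rest)
        where
        inOrbit? = _∈? orbit x
        Ωx = All.head Ωxs
        rest = filter (∁? inOrbit?) xs

        k∣inOrbit : k ∣ length (filter inOrbit? xs)
        k∣inOrbit = ≡.subst (k ∣_) (≡.sym (≡.trans
          (Unique-⊆-⊇⇒length≡ (UniqueP.filter⁺ inOrbit? uxs) (orbit-unique Ωx)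
            (λ y∈ → proj₂ (∈-filter⁻ inOrbit? y∈))
            (λ y∈ → ∈-filter⁺ inOrbit? (closed (here ≡.refl) y∈) y∈))
          (orbit-length Ωx))) ∣-refl

        rest-closed : OrbitClosed orbit rest
        rest-closed y∈ z∈ with ∈-filter⁻ (∁? inOrbit?) y∈
        ... | y∈xs , y∉ = ∈-filter⁺ (∁? inOrbit?) (closed y∈xs z∈)
          (λ z∈x → y∉ (orbit-trans Ωx Ωz z∈x (orbit-sym (All.lookup Ωxs y∈xs) Ωz z∈)))
          where Ωz = All.lookup Ωxs (closed y∈xs z∈)

        k∣rest : k ∣ length rest
        k∣rest = go n rest
          (ℕ.≤-pred (ℕ.≤-trans (ListP.filter-notAll (∁? inOrbit?) xs (here (λ x∉ → x∉ (orbit-refl Ωx)))) len))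
          (UniqueP.filter⁺ (∁? inOrbit?) uxs) (AllP.filter⁺ (∁? inOrbit?) Ωxs) rest-closed

module Residues {q : ℕ} (q%12≡1 : q % 12 ≡ 1) where

  q%d≡1%d : ∀ d .{{_ : ℕ.NonZero d}} → d ∣ 12 → q % d ≡ 1 % d
  q%d≡1%d d d∣12 = ≡.trans (≡.sym (m∣n⇒o%n%m≡o%m d 12 q d∣12)) (≡.cong (_% d) q%12≡1)

  2∤q : ¬ 2 ∣ q
  2∤q 2∣q with ≡.trans (≡.sym (n∣m⇒m%n≡0 q 2 2∣q)) (q%d≡1%d 2 (divides 6 ≡.refl))
  ... | ()

  3∤q : ¬ 3 ∣ q
  3∤q 3∣q with ≡.trans (≡.sym (n∣m⇒m%n≡0 q 3 3∣q)) (q%d≡1%d 3 (divides 4 ≡.refl))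
  ... | ()

  4∤q∸3 : ∀ {n} → n ℕ.+ 3 ≡ q → ¬ 4 ∣ n
  4∤q∸3 {n} n+3≡q (divides m n≡m*4) with begin
    1 % 4                 ≡⟨ q%d≡1%d 4 (divides 3 ≡.refl) ⟨
    q % 4                 ≡⟨ ≡.cong (_% 4) n+3≡q ⟨
    (n ℕ.+ 3) % 4         ≡⟨ ≡.cong (λ k → (k ℕ.+ 3) % 4) n≡m*4 ⟩
    (m ℕ.* 4 ℕ.+ 3) % 4   ≡⟨ ≡.cong (_% 4) (ℕ.+-comm (m ℕ.* 4) 3) ⟩
    (3 ℕ.+ m ℕ.* 4) % 4   ≡⟨ [m+kn]%n≡m%n 3 m 4 ⟩
    3 % 4                 ∎
    where open ≡.≡-Reasoning
  ... | ()

module FiniteFieldFacts {q : ℕ} (F : FiniteField q) where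

  open FiniteField F hiding (zero)
  open Geometry F using (2#; 3#)
  open IntegerCoefficientSolver commRing
  open OrbitCounting (Fin._≟_ {q})
  open import Algebra.Properties.Ring (CommutativeRing.ring commRing)
    using (-‿involutive; -0#≈0#)
  open import Algebra.Properties.Group +-group using (∙-cancelˡ)
  open import Relation.Binary.Reasoning.Setoid setoid

  inverseˡ : ∀ {x} → ¬ x ≈ 0# → x ⁻¹ * x ≈ 1#
  inverseˡ x≉0 = trans (*-comm _ _) (inverseʳ _ x≉0)

  *-cancelˡ-zero : ∀ {x y} → ¬ x ≈ 0# → x * y ≈ 0# → y ≈ 0#
  *-cancelˡ-zero {x} {y} x≉0 xy≈0 = begin
    y                ≈⟨ *-identityˡ y ⟨
    1# * y           ≈⟨ *-congʳ (inverseˡ x≉0) ⟨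
    x ⁻¹ * x * y     ≈⟨ *-assoc _ _ _ ⟩
    x ⁻¹ * (x * y)   ≈⟨ *-congˡ xy≈0 ⟩
    x ⁻¹ * 0#        ≈⟨ zeroʳ _ ⟩
    0#               ∎

  *-nonzero : ∀ {x y} → ¬ x ≈ 0# → ¬ y ≈ 0# → ¬ x * y ≈ 0#
  *-nonzero x≉0 y≉0 xy≈0 = y≉0 (*-cancelˡ-zero x≉0 xy≈0)

  -‿nonzero : ∀ {x} → ¬ x ≈ 0# → ¬ - x ≈ 0#
  -‿nonzero {x} x≉0 -x≈0 = x≉0 (begin
    x        ≈⟨ -‿involutive x ⟨
    - - x    ≈⟨ -‿cong -x≈0 ⟩
    - 0#     ≈⟨ -0#≈0# ⟩
    0#       ∎)

  ⁻¹-unique : ∀ {x y} → x * y ≈ 1# → y ≈ x ⁻¹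
  ⁻¹-unique {x} {y} xy≈1 = begin
    y                 ≈⟨ *-identityʳ y ⟨
    y * 1#            ≈⟨ *-congˡ (inverseʳ x x≉0) ⟨
    y * (x * x ⁻¹)    ≈⟨ solve 3 (λ x y x⁻ → y :* (x :* x⁻) := x :* y :* x⁻) refl x y (x ⁻¹) ⟩
    x * y * x ⁻¹      ≈⟨ *-congʳ xy≈1 ⟩
    1# * x ⁻¹         ≈⟨ *-identityˡ _ ⟩
    x ⁻¹              ∎
    where
    x≉0 : ¬ x ≈ 0#
    x≉0 x≈0 = 1≉0 (trans (sym xy≈1) (trans (*-congʳ x≈0) (zeroˡ y)))

  ⁻¹-nonzero : ∀ {x} → ¬ x ≈ 0# → ¬ x ⁻¹ ≈ 0#
  ⁻¹-nonzero {x} x≉0 x⁻¹≈0 = 1≉0 (trans (sym (inverseʳ x x≉0)) (trans (*-congˡ x⁻¹≈0) (zeroʳ x)))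

  ⁻¹-cong : ∀ {x y} → ¬ x ≈ 0# → x ≈ y → x ⁻¹ ≈ y ⁻¹
  ⁻¹-cong {x} x≉0 x≈y = ⁻¹-unique (trans (*-congʳ (sym x≈y)) (inverseʳ x x≉0))

  ⁻¹-involutive : ∀ {x} → ¬ x ≈ 0# → x ⁻¹ ⁻¹ ≈ x
  ⁻¹-involutive x≉0 = sym (⁻¹-unique (inverseˡ x≉0))

  -‿⁻¹ : ∀ {x} → ¬ x ≈ 0# → (- x) ⁻¹ ≈ - x ⁻¹
  -‿⁻¹ {x} x≉0 = sym (⁻¹-unique (trans
    (solve 2 (λ x x⁻ → :- x :* :- x⁻ := x :* x⁻) refl x (x ⁻¹)) (inverseʳ x x≉0)))

  index : Carrier → Fin q
  index x = proj₁ (enum-surjective x)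

  enum-index : ∀ x → enum (index x) ≈ x
  enum-index x = proj₂ (enum-surjective x)

  index-cong : ∀ {x y} → x ≈ y → index x ≡ index y
  index-cong {x} {y} x≈y = enum-injective _ _ (trans (enum-index x) (trans x≈y (sym (enum-index y))))

  index-injective : ∀ {x y} → index x ≡ index y → x ≈ y
  index-injective {x} {y} eq =
    trans (sym (enum-index x)) (trans (reflexive (≡.cong enum eq)) (enum-index y))

  index-enum : ∀ j → index (enum j) ≡ j
  index-enum j = enum-injective _ _ (enum-index (enum j))

  enum≈ : ∀ {j x} → j ≡ index x → enum j ≈ x
  enum≈ ≡.refl = enum-index _

  infix 4 _≈?_
  _≈?_ : Decidable₂ _≈_
  x ≈? y = map′ index-injective index-cong (index x Fin.≟ index y)

  ∣_∣ : {Ω : Pred Carrier 0ℓ} → Decidable Ω → ℕ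
  ∣ Ω? ∣ = length (filter (Ω? ∘ enum) (allFin q))

  record FreeAction (k : ℕ) (Ω : Pred Carrier 0ℓ) : Set where
    field
      act        : Fin k → Carrier → Carrier
      act-cong   : ∀ g {x y} → Ω x → x ≈ y → act g x ≈ act g y
      act-closed : ∀ g {x} → Ω x → Ω (act g x)
      identity   : ∃ λ e → ∀ x → act e x ≈ x
      compose    : ∀ g h {x} → Ω x → ∃ λ m → act h (act g x) ≈ act m x
      inverse    : ∀ g {x} → Ω x → ∃ λ h → act h (act g x) ≈ x
      free       : ∀ {g h x} → Ω x → act g x ≈ act h x → g ≡ h

  free-action-divides : ∀ {k Ω} (Ω? : Decidable Ω) → (∀ {x y} → x ≈ y → Ω x → Ω y) →
                        FreeAction k Ω → k ∣ ∣ Ω? ∣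
  free-action-divides {k} {Ω} Ω? Ω-resp A =
    orbits-divide (Ω ∘ enum) orbit k
      (λ {i} _ → orbit⁺ (proj₁ identity) (sym (proj₂ identity (enum i))))
      orbit-sym orbit-trans
      (λ Ωi → UniqueP.tabulate⁺ (λ eq → free Ωi (index-injective eq)))
      (λ {i} _ → ListP.length-tabulate (λ g → index (act g (enum i))))
      (filter (Ω? ∘ enum) (allFin q))
      (UniqueP.filter⁺ (Ω? ∘ enum) (UniqueP.allFin⁺ q))
      (AllP.all-filter (Ω? ∘ enum) (allFin q))
      closed
    where
    open FreeAction A

    orbit : Fin q → List (Fin q)
    orbit i = tabulate (λ g → index (act g (enum i)))

    orbit⁺ : ∀ g {i j} → enum j ≈ act g (enum i) → j ∈ orbit i
    orbit⁺ g {i} {j} j≈gi =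
      ≡.subst (_∈ orbit i) (≡.trans (index-cong (sym j≈gi)) (index-enum j)) (∈-tabulate⁺ g)

    orbit⁻ : ∀ {i j} → j ∈ orbit i → ∃ λ g → enum j ≈ act g (enum i)
    orbit⁻ j∈ with ∈-tabulate⁻ j∈
    ... | g , ≡.refl = g , enum-index _

    orbit-sym : ∀ {i j} → Ω (enum i) → Ω (enum j) → j ∈ orbit i → i ∈ orbit j
    orbit-sym {i} {j} Ωi Ωj j∈ with orbit⁻ j∈
    ... | g , j≈gi with inverse g Ωi
    ... | h , hgi≈i = orbit⁺ h (sym (trans (act-cong h Ωj j≈gi) hgi≈i))

    orbit-trans : ∀ {i j l} → Ω (enum i) → Ω (enum j) → j ∈ orbit i → l ∈ orbit j → l ∈ orbit i
    orbit-trans {i} Ωi Ωj j∈ l∈ with orbit⁻ j∈ | orbit⁻ l∈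
    ... | g , j≈gi | h , l≈hj with compose g h Ωi
    ... | m , hgi≈mi = orbit⁺ m (trans l≈hj (trans (act-cong h Ωj j≈gi) hgi≈mi))

    closed : OrbitClosed orbit (filter (Ω? ∘ enum) (allFin q))
    closed {i} {j} i∈ j∈ with orbit⁻ j∈
    ... | g , j≈gi = ∈-filter⁺ (Ω? ∘ enum) (∈-allFin j)
                       (Ω-resp (sym j≈gi) (act-closed g (proj₂ (∈-filter⁻ (Ω? ∘ enum) {xs = allFin q} i∈))))

  ∣U∣≡q : ∣ U? ∣ ≡ q
  ∣U∣≡q = ≡.trans (≡.cong length (ListP.filter-all (U? ∘ enum) (All.universal (λ _ → tt) (allFin q))))
                  (ListP.length-tabulate {n = q} id)

  module _ {k : ℕ} (t : Fin k → Carrier)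
           (t-zero : ∃ λ e → t e ≈ 0#)
           (t-+ : ∀ g h → ∃ λ m → t g + t h ≈ t m)
           (t-neg : ∀ g → ∃ λ h → t g + t h ≈ 0#)
           (t-injective : ∀ {g h} → t g ≈ t h → g ≡ h)
           where

    translations : FreeAction k U
    translations = record
      { act        = λ g x → x + t g
      ; act-cong   = λ _ _ → +-congʳ
      ; act-closed = λ _ _ → tt
      ; identity   = proj₁ t-zero , λ x → trans (+-congˡ (proj₂ t-zero)) (+-identityʳ x)
      ; compose    = λ g h _ → proj₁ (t-+ g h) , trans (+-assoc _ _ _) (+-congˡ (proj₂ (t-+ g h)))
      ; inverse    = λ g _ → proj₁ (t-neg g) ,
                       trans (+-assoc _ _ _) (trans (+-congˡ (proj₂ (t-neg g))) (+-identityʳ _))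
      ; free       = λ _ eq → t-injective (∙-cancelˡ _ _ _ eq)
      }

    subgroup-order-divides : k ∣ q
    subgroup-order-divides = ≡.subst (k ∣_) ∣U∣≡q (free-action-divides U? (λ _ _ → tt) translations)

  2∤q⇒2≉0 : ¬ 2 ∣ q → ¬ 2# ≈ 0#
  2∤q⇒2≉0 2∤q 2≈0 = 2∤q (subgroup-order-divides t (0F , refl) t-+ (λ g → g , t-double g) t-injective)
    where
    t : Fin 2 → Carrier
    t 0F = 0#
    t 1F = 1#

    t-double : ∀ g → t g + t g ≈ 0#
    t-double 0F = +-identityˡ 0#
    t-double 1F = 2≈0

    t-+ : ∀ g h → ∃ λ m → t g + t h ≈ t m
    t-+ 0F h  = h , +-identityˡ _
    t-+ 1F 0F = 1F , +-identityʳ _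
    t-+ 1F 1F = 0F , 2≈0

    t-injective : ∀ {g h} → t g ≈ t h → g ≡ h
    t-injective {0F} {0F} _ = ≡.refl
    t-injective {1F} {1F} _ = ≡.refl
    t-injective {0F} {1F} 0≈1 = ⊥-elim (1≉0 (sym 0≈1))
    t-injective {1F} {0F} 1≈0 = ⊥-elim (1≉0 1≈0)

  3∤q⇒3≉0 : ¬ 3 ∣ q → ¬ 2# ≈ 0# → ¬ 3# ≈ 0#
  3∤q⇒3≉0 3∤q 2≉0 3≈0 = 3∤q (subgroup-order-divides t (0F , refl) t-+ t-neg t-injective)
    where
    t : Fin 3 → Carrier
    t 0F = 0#
    t 1F = 1#
    t 2F = 2#

    1+2≈0 : 1# + 2# ≈ 0#
    1+2≈0 = trans (sym (+-assoc 1# 1# 1#)) 3≈0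

    t-+ : ∀ g h → ∃ λ m → t g + t h ≈ t m
    t-+ 0F h  = h , +-identityˡ _
    t-+ g  0F = g , +-identityʳ _
    t-+ 1F 1F = 2F , refl
    t-+ 1F 2F = 0F , 1+2≈0
    t-+ 2F 1F = 0F , 3≈0
    t-+ 2F 2F = 1F , trans (solve 0 (κ 2 :+ κ 2 := κ 1 :+ κ 3) refl)
                           (trans (+-congˡ 3≈0) (+-identityʳ 1#))

    t-neg : ∀ g → ∃ λ h → t g + t h ≈ 0#
    t-neg 0F = 0F , +-identityˡ 0#
    t-neg 1F = 2F , 1+2≈0
    t-neg 2F = 1F , 3≈0

    t-injective : ∀ {g h} → t g ≈ t h → g ≡ h
    t-injective {0F} {0F} _ = ≡.refl
    t-injective {1F} {1F} _ = ≡.refl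
    t-injective {2F} {2F} _ = ≡.refl
    t-injective {0F} {1F} 0≈1 = ⊥-elim (1≉0 (sym 0≈1))
    t-injective {1F} {0F} 1≈0 = ⊥-elim (1≉0 1≈0)
    t-injective {0F} {2F} 0≈2 = ⊥-elim (2≉0 (sym 0≈2))
    t-injective {2F} {0F} 2≈0 = ⊥-elim (2≉0 2≈0)
    t-injective {1F} {2F} 1≈2 = ⊥-elim (1≉0 (sym (∙-cancelˡ 1# 0# 1# (trans (+-identityʳ 1#) 1≈2))))
    t-injective {2F} {1F} 2≈1 = ⊥-elim (1≉0 (sym (∙-cancelˡ 1# 0# 1# (trans (+-identityʳ 1#) (sym 2≈1)))))

  x³≈-½⇒[-2x²]³≈-2 : ¬ 2# ≈ 0# → ∀ {x} → x * x * x ≈ - (2# ⁻¹) →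
                     let r = - (2# * (x * x)) in r * r * r + 2# ≈ 0#
  x³≈-½⇒[-2x²]³≈-2 2≉0 {x} x³≈-½ = ≈-modulo₂
    (solve 2 (λ x h → let r = :- (κ 2 :* (x :* x)) in
       r :* r :* r :+ κ 2 := κ 0 :+ (:- κ 8 :* (x :* x :* x :- h) :* (x :* x :* x :+ h)
                                     :+ :- κ 2 :* (κ 2 :* h :+ κ 1) :* (κ 2 :* h :- κ 1)))
       refl x (2# ⁻¹))
    (trans (+-congʳ x³≈-½) (-‿inverseˡ _))
    (trans (+-congʳ (inverseʳ 2# 2≉0)) (-‿inverseʳ 1#))

  y⁴≈-⅓⇒[3y³]⁴≈-3 : ¬ 3# ≈ 0# → ∀ {y} → y * y * y * y ≈ - (3# ⁻¹) →
                    let s = 3# * (y * y * y) in s * s * s * s + 3# ≈ 0#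
  y⁴≈-⅓⇒[3y³]⁴≈-3 3≉0 {y} y⁴≈-⅓ = ≈-modulo₂
    (solve 2 (λ y t → let s = κ 3 :* (y :* y :* y) in
       s :* s :* s :* s :+ κ 3 := κ 0 :+ (κ 81 :* (y :^ 8 :- t :* y :^ 4 :+ t :* t) :* (y :* y :* y :* y :+ t)
                                          :+ :- κ 3 :* (κ 9 :* t :* t :+ κ 3 :* t :+ κ 1) :* (κ 3 :* t :- κ 1)))
       refl y (3# ⁻¹))
    (trans (+-congʳ y⁴≈-⅓) (-‿inverseˡ _))
    (trans (+-congʳ (inverseʳ 3# 3≉0)) (-‿inverseʳ 1#))

  Off0±1 : Pred Carrier 0ℓ
  Off0±1 x = ¬ x ≈ 0# × ¬ x ≈ 1# × ¬ x ≈ - 1#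

  Off0±1? : Decidable Off0±1
  Off0±1? x = ¬? (x ≈? 0#) ×-dec ¬? (x ≈? 1#) ×-dec ¬? (x ≈? - 1#)

  Off0±1-resp : ∀ {x y} → x ≈ y → Off0±1 x → Off0±1 y
  Off0±1-resp x≈y (x≉0 , x≉1 , x≉-1) =
    (λ y≈0 → x≉0 (trans x≈y y≈0)) , (λ y≈1 → x≉1 (trans x≈y y≈1)) , (λ y≈-1 → x≉-1 (trans x≈y y≈-1))

  -‿injective : ∀ {x y} → - x ≈ - y → x ≈ y
  -‿injective {x} {y} -x≈-y = trans (sym (-‿involutive x)) (trans (-‿cong -x≈-y) (-‿involutive y))

  ⁻¹-self-inverse : ∀ {x c} → ¬ x ≈ 0# → c * c ≈ 1# → x ⁻¹ ≈ c → x ≈ c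
  ⁻¹-self-inverse x≉0 cc≈1 x⁻¹≈c =
    trans (sym (⁻¹-involutive x≉0)) (trans (⁻¹-cong (⁻¹-nonzero x≉0) x⁻¹≈c) (sym (⁻¹-unique cc≈1)))

  -‿Off0±1 : ∀ {x} → Off0±1 x → Off0±1 (- x)
  -‿Off0±1 (x≉0 , x≉1 , x≉-1) =
    -‿nonzero x≉0 , (λ -x≈1 → x≉-1 (-‿injective (trans -x≈1 (sym (-‿involutive 1#))))) ,
    (λ -x≈-1 → x≉1 (-‿injective -x≈-1))

  ⁻¹-Off0±1 : ∀ {x} → Off0±1 x → Off0±1 (x ⁻¹)
  ⁻¹-Off0±1 (x≉0 , x≉1 , x≉-1) =
    ⁻¹-nonzero x≉0 , (λ x⁻¹≈1 → x≉1 (⁻¹-self-inverse x≉0 (*-identityˡ 1#) x⁻¹≈1)) ,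
    (λ x⁻¹≈-1 → x≉-1 (⁻¹-self-inverse x≉0 -1*-1≈1 x⁻¹≈-1))
    where
    -1*-1≈1 : - 1# * - 1# ≈ 1#
    -1*-1≈1 = solve 0 (:- κ 1 :* :- κ 1 := κ 1) refl

  -- {x, -x, x⁻¹, -x⁻¹} is a Klein four-group acting on F ∖ {0, 1, -1}, freely when -1 is not a
  -- square.
  module _ (2≉0 : ¬ 2# ≈ 0#) (no-√-1 : ∀ x → ¬ x * x ≈ - 1#) where

    x≉-x : ∀ {x} → ¬ x ≈ 0# → ¬ x ≈ - x
    x≉-x {x} x≉0 x≈-x = x≉0 (*-cancelˡ-zero 2≉0 (begin
      2# * x     ≈⟨ solve 1 (λ x → κ 2 :* x := x :+ x) refl x ⟩
      x + x      ≈⟨ +-congˡ x≈-x ⟩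
      x - x      ≈⟨ -‿inverseʳ x ⟩
      0#         ∎))

    x≉x⁻¹ : ∀ {x} → Off0±1 x → ¬ x ≈ x ⁻¹
    x≉x⁻¹ {x} (x≉0 , x≉1 , x≉-1) x≈x⁻¹ = x≉-1 (begin
      x               ≈⟨ solve 1 (λ x → x := x :+ κ 1 :- κ 1) refl x ⟩
      x + 1# - 1#     ≈⟨ +-congʳ (*-cancelˡ-zero x-1≉0 (begin
        (x - 1#) * (x + 1#)   ≈⟨ solve 1 (λ x → (x :- κ 1) :* (x :+ κ 1) := x :* x :- κ 1) refl x ⟩
        x * x - 1#            ≈⟨ +-congʳ (trans (*-congˡ x≈x⁻¹) (inverseʳ x x≉0)) ⟩
        1# - 1#               ≈⟨ -‿inverseʳ 1# ⟩
        0#                    ∎)) ⟩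
      0# - 1#         ≈⟨ +-identityˡ _ ⟩
      - 1#            ∎)
      where
      x-1≉0 : ¬ x - 1# ≈ 0#
      x-1≉0 x-1≈0 = x≉1 (trans (solve 1 (λ x → x := x :- κ 1 :+ κ 1) refl x)
                               (trans (+-congʳ x-1≈0) (+-identityˡ 1#)))

    x≉-x⁻¹ : ∀ {x} → ¬ x ≈ 0# → ¬ x ≈ - x ⁻¹
    x≉-x⁻¹ {x} x≉0 x≈-x⁻¹ = no-√-1 x (begin
      x * x           ≈⟨ *-congˡ x≈-x⁻¹ ⟩
      x * - x ⁻¹      ≈⟨ solve 2 (λ x x⁻ → x :* :- x⁻ := :- (x :* x⁻)) refl x (x ⁻¹) ⟩
      - (x * x ⁻¹)    ≈⟨ -‿cong (inverseʳ x x≉0) ⟩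
      - 1#            ∎)

    -x≉x⁻¹ : ∀ {x} → ¬ x ≈ 0# → ¬ - x ≈ x ⁻¹
    -x≉x⁻¹ {x} x≉0 -x≈x⁻¹ =
      x≉-x⁻¹ x≉0 (trans (sym (-‿involutive x)) (-‿cong -x≈x⁻¹))

    klein : FreeAction 4 Off0±1
    klein = record
      { act = act ; act-cong = act-cong ; act-closed = act-closed ; identity = 0F , λ _ → refl
      ; compose = compose ; inverse = λ g Ωx → g , involutive g Ωx ; free = free }
      where
      act : Fin 4 → Carrier → Carrier
      act 0F x = x
      act 1F x = - x
      act 2F x = x ⁻¹
      act 3F x = - x ⁻¹

      act-cong : ∀ g {x y} → Off0±1 x → x ≈ y → act g x ≈ act g y
      act-cong 0F _ x≈y = x≈y
      act-cong 1F _ x≈y = -‿cong x≈y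
      act-cong 2F (x≉0 , _) x≈y = ⁻¹-cong x≉0 x≈y
      act-cong 3F (x≉0 , _) x≈y = -‿cong (⁻¹-cong x≉0 x≈y)

      act-closed : ∀ g {x} → Off0±1 x → Off0±1 (act g x)
      act-closed 0F Ωx = Ωx
      act-closed 1F Ωx = -‿Off0±1 Ωx
      act-closed 2F Ωx = ⁻¹-Off0±1 Ωx
      act-closed 3F Ωx = -‿Off0±1 (⁻¹-Off0±1 Ωx)

      involutive : ∀ g {x} → Off0±1 x → act g (act g x) ≈ x
      involutive 0F _ = refl
      involutive 1F _ = -‿involutive _
      involutive 2F (x≉0 , _) = ⁻¹-involutive x≉0
      involutive 3F (x≉0 , _) =
        trans (-‿cong (-‿⁻¹ (⁻¹-nonzero x≉0))) (trans (-‿involutive _) (⁻¹-involutive x≉0))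

      compose : ∀ g h {x} → Off0±1 x → ∃ λ m → act h (act g x) ≈ act m x
      compose g  0F _ = g , refl
      compose 0F h  _ = h , refl
      compose 1F 1F Ωx = 0F , involutive 1F Ωx
      compose 2F 1F _  = 3F , refl
      compose 3F 1F _  = 2F , -‿involutive _
      compose 1F 2F (x≉0 , _) = 3F , -‿⁻¹ x≉0
      compose 2F 2F Ωx = 0F , involutive 2F Ωx
      compose 3F 2F (x≉0 , _) = 1F , trans (-‿⁻¹ (⁻¹-nonzero x≉0)) (-‿cong (⁻¹-involutive x≉0))
      compose 1F 3F (x≉0 , _) = 2F , trans (-‿cong (-‿⁻¹ x≉0)) (-‿involutive _)
      compose 2F 3F (x≉0 , _) = 1F , -‿cong (⁻¹-involutive x≉0)
      compose 3F 3F Ωx = 0F , involutive 3F Ωx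

      free : ∀ {g h x} → Off0±1 x → act g x ≈ act h x → g ≡ h
      free {0F} {0F} _ _ = ≡.refl
      free {1F} {1F} _ _ = ≡.refl
      free {2F} {2F} _ _ = ≡.refl
      free {3F} {3F} _ _ = ≡.refl
      free {0F} {1F} (x≉0 , _) e = ⊥-elim (x≉-x x≉0 e)
      free {1F} {0F} (x≉0 , _) e = ⊥-elim (x≉-x x≉0 (sym e))
      free {0F} {2F} Ωx e = ⊥-elim (x≉x⁻¹ Ωx e)
      free {2F} {0F} Ωx e = ⊥-elim (x≉x⁻¹ Ωx (sym e))
      free {0F} {3F} (x≉0 , _) e = ⊥-elim (x≉-x⁻¹ x≉0 e)
      free {3F} {0F} (x≉0 , _) e = ⊥-elim (x≉-x⁻¹ x≉0 (sym e))
      free {1F} {2F} (x≉0 , _) e = ⊥-elim (-x≉x⁻¹ x≉0 e)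
      free {2F} {1F} (x≉0 , _) e = ⊥-elim (-x≉x⁻¹ x≉0 (sym e))
      free {1F} {3F} Ωx e = ⊥-elim (x≉x⁻¹ Ωx (-‿injective e))
      free {3F} {1F} Ωx e = ⊥-elim (x≉x⁻¹ Ωx (sym (-‿injective e)))
      free {2F} {3F} (x≉0 , _) e = ⊥-elim (x≉-x (⁻¹-nonzero x≉0) e)
      free {3F} {2F} (x≉0 , _) e = ⊥-elim (x≉-x (⁻¹-nonzero x≉0) (sym e))

    4∣∣Off0±1∣ : 4 ∣ ∣ Off0±1? ∣
    4∣∣Off0±1∣ = free-action-divides Off0±1? Off0±1-resp klein

  ∣Off0±1∣+3≡q : ¬ 2# ≈ 0# → ∣ Off0±1? ∣ ℕ.+ 3 ≡ q
  ∣Off0±1∣+3≡q 2≉0 = ≡.trans (≡.cong (∣ Off0±1? ∣ ℕ.+_) (≡.sym ∣exceptional∣≡3))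
                             (≡.trans (length-filter-∁ (Off0±1? ∘ enum) (allFin q))
                                      (ListP.length-tabulate {n = q} id))
    where
    exceptional : List (Fin q)
    exceptional = filter (∁? (Off0±1? ∘ enum)) (allFin q)

    -1≉0 : ¬ - 1# ≈ 0#
    -1≉0 = -‿nonzero 1≉0

    1≉-1 : ¬ 1# ≈ - 1#
    1≉-1 1≈-1 = 2≉0 (trans (+-congˡ 1≈-1) (-‿inverseʳ 1#))

    0±1 : List (Fin q)
    0±1 = index 0# ∷ index 1# ∷ index (- 1#) ∷ []

    0±1-unique : Unique 0±1
    0±1-unique =
      ((λ e → 1≉0 (sym (index-injective e))) ∷ (λ e → -1≉0 (sym (index-injective e))) ∷ []) ∷
      ((λ e → 1≉-1 (index-injective e)) ∷ []) ∷ [] ∷ []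

    exceptional⊆0±1 : exceptional ⊆ 0±1
    exceptional⊆0±1 {j} j∈ with proj₂ (∈-filter⁻ (∁? (Off0±1? ∘ enum)) {xs = allFin q} j∈)
    ... | ¬Ωj with enum j ≈? 0# | enum j ≈? 1# | enum j ≈? - 1#
    ... | yes j≈0 | _       | _        = here (≡.trans (≡.sym (index-enum j)) (index-cong j≈0))
    ... | no _    | yes j≈1 | _        = there (here (≡.trans (≡.sym (index-enum j)) (index-cong j≈1)))
    ... | no _    | no _    | yes j≈-1 = there (there (here (≡.trans (≡.sym (index-enum j)) (index-cong j≈-1))))
    ... | no j≉0  | no j≉1  | no j≉-1  = ⊥-elim (¬Ωj (j≉0 , j≉1 , j≉-1))

    0±1⊆exceptional : 0±1 ⊆ exceptional
    0±1⊆exceptional {j} (here j≡)                 = ∈-filter⁺ _ (∈-allFin j) λ Ωj → proj₁ Ωj (enum≈ j≡)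
    0±1⊆exceptional {j} (there (here j≡))         = ∈-filter⁺ _ (∈-allFin j) λ Ωj → proj₁ (proj₂ Ωj) (enum≈ j≡)
    0±1⊆exceptional {j} (there (there (here j≡))) = ∈-filter⁺ _ (∈-allFin j) λ Ωj → proj₂ (proj₂ Ωj) (enum≈ j≡)

    ∣exceptional∣≡3 : length exceptional ≡ 3
    ∣exceptional∣≡3 = Unique-⊆-⊇⇒length≡ (UniqueP.filter⁺ _ (UniqueP.allFin⁺ q)) 0±1-unique
                        exceptional⊆0±1 0±1⊆exceptional

  module _ (q%12≡1 : q % 12 ≡ 1) where

    open Residues {q} q%12≡1

    2≉0 : ¬ 2# ≈ 0#
    2≉0 = 2∤q⇒2≉0 2∤q

    3≉0 : ¬ 3# ≈ 0#
    3≉0 = 3∤q⇒3≉0 3∤q 2≉0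

    √-1 : ∃ λ i → i * i ≈ - 1#
    √-1 with FinP.any? (λ j → enum j * enum j ≈? - 1#)
    ... | yes (j , jj≈-1) = enum j , jj≈-1
    ... | no ∄√-1 = ⊥-elim (4∤q∸3 (∣Off0±1∣+3≡q 2≉0) (4∣∣Off0±1∣ 2≉0 no-√-1))
      where
      no-√-1 : ∀ x → ¬ x * x ≈ - 1#
      no-√-1 x xx≈-1 = ∄√-1 (index x , trans (*-cong (enum-index x) (enum-index x)) xx≈-1)

module NullPolarity {q : ℕ} (F : FiniteField q) where

  open FiniteField F hiding (zero)
  open Geometry F
  open IntegerCoefficientSolver commRing
  open FiniteFieldFacts F using (*-cancelˡ-zero; *-nonzero)
  open import Relation.Binary.Reasoning.Setoid setoid

  -- Syntactic twins of vec, cubicMat, _·M_ and ω for the solver; their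
  -- denotations are definitionally the originals.
  module _ {n : ℕ} where

    vecₚ : Polynomial n → Polynomial n → Polynomial n → Polynomial n → Fin 4 → Polynomial n
    vecₚ x₀ x₁ x₂ x₃ 0F = x₀
    vecₚ x₀ x₁ x₂ x₃ 1F = x₁
    vecₚ x₀ x₁ x₂ x₃ 2F = x₂
    vecₚ x₀ x₁ x₂ x₃ 3F = x₃

    cubicMatₚ : Polynomial n → Polynomial n → Polynomial n → Polynomial n → Fin 4 → Fin 4 → Polynomial n
    cubicMatₚ a b c d 0F = vecₚ (a :* a :* a) (a :* a :* c) (a :* c :* c) (c :* c :* c)
    cubicMatₚ a b c d 1F =
      vecₚ (κ 3 :* (a :* a :* b)) (a :* a :* d :+ κ 2 :* (a :* b :* c))
           (b :* c :* c :+ κ 2 :* (a :* c :* d)) (κ 3 :* (c :* c :* d))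
    cubicMatₚ a b c d 2F =
      vecₚ (κ 3 :* (a :* b :* b)) (b :* b :* c :+ κ 2 :* (a :* b :* d))
           (a :* d :* d :+ κ 2 :* (b :* c :* d)) (κ 3 :* (c :* d :* d))
    cubicMatₚ a b c d 3F = vecₚ (b :* b :* b) (b :* b :* d) (b :* d :* d) (d :* d :* d)

    _·Mₚ_ : (Fin 4 → Polynomial n) → (Fin 4 → Fin 4 → Polynomial n) → Fin 4 → Polynomial n
    (x ·Mₚ M) j = x 0F :* M 0F j :+ x 1F :* M 1F j :+ x 2F :* M 2F j :+ x 3F :* M 3F j

    ωₚ : (Fin 4 → Polynomial n) → (Fin 4 → Polynomial n) → Polynomial n
    ωₚ x y = x 0F :* y 3F :- κ 3 :* (x 1F :* y 2F) :+ κ 3 :* (x 2F :* y 1F) :- x 3F :* y 0F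

  ω : Vec4 → Vec4 → Carrier
  ω x y = x 0F * y 3F - 3# * (x 1F * y 2F) + 3# * (x 2F * y 1F) - x 3F * y 0F

  ω-cong : ∀ {x x′ y y′} → (∀ i → x i ≈ x′ i) → (∀ i → y i ≈ y′ i) → ω x y ≈ ω x′ y′
  ω-cong x≈ y≈ =
    +-cong (+-cong (+-cong (*-cong (x≈ 0F) (y≈ 3F)) (-‿cong (*-congˡ (*-cong (x≈ 1F) (y≈ 2F)))))
                   (*-congˡ (*-cong (x≈ 2F) (y≈ 1F))))
           (-‿cong (*-cong (x≈ 3F) (y≈ 0F)))

  ω-·M : ∀ a b c d (x y : Vec4) →
         ω (x ·M cubicMat a b c d) (y ·M cubicMat a b c d) ≈
         (a * d - b * c) * (a * d - b * c) * (a * d - b * c) * ω x y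
  ω-·M a b c d x y = solve 12
    (λ a b c d x₀ x₁ x₂ x₃ y₀ y₁ y₂ y₃ →
       let x = vecₚ x₀ x₁ x₂ x₃
           y = vecₚ y₀ y₁ y₂ y₃
           Δ = a :* d :- b :* c
       in ωₚ (x ·Mₚ cubicMatₚ a b c d) (y ·Mₚ cubicMatₚ a b c d) := Δ :* Δ :* Δ :* ωₚ x y)
    refl a b c d (x 0F) (x 1F) (x 2F) (x 3F) (y 0F) (y 1F) (y 2F) (y 3F)

  ·M-cong : ∀ {x x′} (N : Mat4) → (∀ i → x i ≈ x′ i) → ∀ j → (x ·M N) j ≈ (x′ ·M N) j
  ·M-cong N x≈ j =
    +-cong (+-cong (+-cong (*-congʳ (x≈ 0F)) (*-congʳ (x≈ 1F))) (*-congʳ (x≈ 2F))) (*-congʳ (x≈ 3F))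

  ·M-linear : ∀ {x A B l m} (N : Mat4) → (∀ i → x i ≈ l * A i + m * B i) →
              ∀ j → (x ·M N) j ≈ l * (A ·M N) j + m * (B ·M N) j
  ·M-linear {A = A} {B} {l} {m} N x≈ j = trans (·M-cong N x≈ j) (solve 14
    (λ l m a₀ a₁ a₂ a₃ b₀ b₁ b₂ b₃ n₀ n₁ n₂ n₃ →
       let column = λ i (_ : Fin 4) → vecₚ n₀ n₁ n₂ n₃ i
           a = vecₚ a₀ a₁ a₂ a₃
           b = vecₚ b₀ b₁ b₂ b₃
       in ((λ i → l :* a i :+ m :* b i) ·Mₚ column) j
          := l :* (a ·Mₚ column) j :+ m :* (b ·Mₚ column) j)
    refl l m (A 0F) (A 1F) (A 2F) (A 3F) (B 0F) (B 1F) (B 2F) (B 3F) (N 0F j) (N 1F j) (N 2F j) (N 3F j))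

  OnLine-combination : ∀ {C D P Q w l m} → OnLine C D P → OnLine C D Q →
                       (∀ i → w i ≈ l * P i + m * Q i) → OnLine C D w
  OnLine-combination {C} {D} {l = l} {m} (l₁ , m₁ , P≈) (l₂ , m₂ , Q≈) w≈ =
    l * l₁ + m * l₂ , l * m₁ + m * m₂ , λ i →
      trans (w≈ i) (trans (+-cong (*-congˡ (P≈ i)) (*-congˡ (Q≈ i))) (solve 8
        (λ l m l₁ m₁ l₂ m₂ c d → l :* (l₁ :* c :+ m₁ :* d) :+ m :* (l₂ :* c :+ m₂ :* d)
                                 := (l :* l₁ :+ m :* l₂) :* c :+ (l :* m₁ :+ m :* m₂) :* d)
        refl l m l₁ m₁ l₂ m₂ (C i) (D i)))

  OnLine-·M : ∀ {A B C D x} (N : Mat4) → OnLine C D (A ·M N) → OnLine C D (B ·M N) →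
              OnLine A B x → OnLine C D (x ·M N)
  OnLine-·M N A↦ B↦ (_ , _ , x≈) = OnLine-combination A↦ B↦ (·M-linear N x≈)

  ω-isotropic : ∀ {C D x y} → ω C D ≈ 0# → OnLine C D x → OnLine C D y → ω x y ≈ 0#
  ω-isotropic {C} {D} {x} {y} ωCD≈0 (l , m , x≈) (l′ , m′ , y≈) = begin
    ω x y                                                   ≈⟨ ω-cong x≈ y≈ ⟩
    ω (λ i → l * C i + m * D i) (λ i → l′ * C i + m′ * D i) ≈⟨ solve 12
      (λ l m l′ m′ c₀ c₁ c₂ c₃ d₀ d₁ d₂ d₃ →
         let c = vecₚ c₀ c₁ c₂ c₃
             d = vecₚ d₀ d₁ d₂ d₃
         in ωₚ (λ i → l :* c i :+ m :* d i) (λ i → l′ :* c i :+ m′ :* d i)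
            := (l :* m′ :- m :* l′) :* ωₚ c d)
      refl l m l′ m′ (C 0F) (C 1F) (C 2F) (C 3F) (D 0F) (D 1F) (D 2F) (D 3F) ⟩
    (l * m′ - m * l′) * ω C D                              ≈⟨ *-congˡ ωCD≈0 ⟩
    (l * m′ - m * l′) * 0#                                 ≈⟨ zeroʳ _ ⟩
    0#                                                      ∎

  -- If x ·M M lies on the isotropic line CD, it pairs to zero with A ·M M and B ·M M, so x pairs
  -- to zero with A and B and therefore lies on AB.
  maps-self-polar-line : ∀ {a b c d A B C D} → ¬ (a * d - b * c ≈ 0#) →
    (∀ w → ω A w ≈ 0# → ω B w ≈ 0# → OnLine A B w) → ω C D ≈ 0# →
    OnLine C D (A ·M cubicMat a b c d) → OnLine C D (B ·M cubicMat a b c d) →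
    MapsLineOnto a b c d A B C D
  maps-self-polar-line {a} {b} {c} {d} {A} {B} {C} {D} Δ≉0 AB-self-polar CD-isotropic A↦ B↦ x _ =
    mk⇔ (OnLine-·M M A↦ B↦) λ x↦ → AB-self-polar x (ω-vanishes A A↦ x↦) (ω-vanishes B B↦ x↦)
    where
    M : Mat4
    M = cubicMat a b c d

    ω-vanishes : ∀ P → OnLine C D (P ·M M) → OnLine C D (x ·M M) → ω P x ≈ 0#
    ω-vanishes P P↦ x↦ = *-cancelˡ-zero (*-nonzero (*-nonzero Δ≉0 Δ≉0) Δ≉0)
      (trans (sym (ω-·M a b c d P x)) (ω-isotropic CD-isotropic P↦ x↦))

module LineOrbit {q : ℕ} (F : FiniteField q) where

  open FiniteField F hiding (zero)
  open Geometry F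
  open IntegerCoefficientSolver commRing
  open FiniteFieldFacts F using (*-cancelˡ-zero; *-nonzero)
  open NullPolarity F
  open import Algebra.Properties.Group +-group using (x∙y⁻¹≈ε⇒x≈y; inverseʳ-unique)
  open import Relation.Binary.Reasoning.Setoid setoid

  L₁ L₂ ℓ₁ ℓ₂ : Vec4
  L₁ = vec 1# 0# 0# 1#
  L₂ = vec 0# 0# 1# 0#
  ℓ₁ = vec 0# (- (3# ⁻¹)) 0# 1#
  ℓ₂ = vec 1# 0# 1# 0#

  module _ (3≉0 : ¬ 3# ≈ 0#) where

    L-self-polar : ∀ w → ω L₁ w ≈ 0# → ω L₂ w ≈ 0# → OnLine L₁ L₂ w
    L-self-polar w ωL₁w≈0 ωL₂w≈0 = w 0F , w 2F , λ
      { 0F → solve 2 (λ u v → u := u :* κ 1 :+ v :* κ 0) refl (w 0F) (w 2F)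
      ; 1F → trans w₁≈0 (solve 2 (λ u v → κ 0 := u :* κ 0 :+ v :* κ 0) refl (w 0F) (w 2F))
      ; 2F → solve 2 (λ u v → v := u :* κ 0 :+ v :* κ 1) refl (w 0F) (w 2F)
      ; 3F → trans w₃≈w₀ (solve 2 (λ u v → u := u :* κ 1 :+ v :* κ 0) refl (w 0F) (w 2F))
      }
      where
      w₃≈w₀ : w 3F ≈ w 0F
      w₃≈w₀ = x∙y⁻¹≈ε⇒x≈y _ _ (trans (sym (solve 4
        (λ w₀ w₁ w₂ w₃ → ωₚ (vecₚ (κ 1) (κ 0) (κ 0) (κ 1)) (vecₚ w₀ w₁ w₂ w₃) := w₃ :- w₀)
        refl (w 0F) (w 1F) (w 2F) (w 3F))) ωL₁w≈0)

      w₁≈0 : w 1F ≈ 0#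
      w₁≈0 = *-cancelˡ-zero 3≉0 (trans (sym (solve 4
        (λ w₀ w₁ w₂ w₃ → ωₚ (vecₚ (κ 0) (κ 0) (κ 1) (κ 0)) (vecₚ w₀ w₁ w₂ w₃) := κ 3 :* w₁)
        refl (w 0F) (w 1F) (w 2F) (w 3F))) ωL₂w≈0)

    ℓ-isotropic : ω ℓ₁ ℓ₂ ≈ 0#
    ℓ-isotropic = begin
      ω ℓ₁ ℓ₂             ≈⟨ solve 1 (λ t → ωₚ (vecₚ (κ 0) (:- t) (κ 0) (κ 1)) (vecₚ (κ 1) (κ 0) (κ 1) (κ 0))
                                            := κ 3 :* t :- κ 1) refl (3# ⁻¹) ⟩
      3# * 3# ⁻¹ - 1#     ≈⟨ +-congʳ (inverseʳ 3# 3≉0) ⟩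
      1# - 1#             ≈⟨ -‿inverseʳ 1# ⟩
      0#                  ∎

    on-ℓ : ∀ w → w 2F ≈ w 0F → w 3F + 3# * w 1F ≈ 0# → OnLine ℓ₁ ℓ₂ w
    on-ℓ w w₂≈w₀ w₃+3w₁≈0 = w 3F , w 0F , λ
      { 0F → solve 2 (λ u v → v := u :* κ 0 :+ v :* κ 1) refl (w 3F) (w 0F)
      ; 1F → begin
          w 1F                               ≈⟨ *-identityˡ _ ⟨
          1# * w 1F                          ≈⟨ *-congʳ (trans (*-comm _ _) (inverseʳ 3# 3≉0)) ⟨
          3# ⁻¹ * 3# * w 1F                  ≈⟨ *-assoc _ _ _ ⟩
          3# ⁻¹ * (3# * w 1F)                ≈⟨ *-congˡ (inverseʳ-unique _ _ w₃+3w₁≈0) ⟩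
          3# ⁻¹ * - w 3F                     ≈⟨ solve 3 (λ t u v → t :* :- u := u :* :- t :+ v :* κ 0)
                                                   refl (3# ⁻¹) (w 3F) (w 0F) ⟩
          w 3F * - (3# ⁻¹) + w 0F * 0#       ∎
      ; 2F → trans w₂≈w₀ (solve 2 (λ u v → v := u :* κ 0 :+ v :* κ 1) refl (w 3F) (w 0F))
      ; 3F → solve 2 (λ u v → u := u :* κ 1 :+ v :* κ 0) refl (w 3F) (w 0F)
      }

  module _ (i r s : Carrier)
           (i²+1≈0 : i * i + 1# ≈ 0#) (r³+2≈0 : r * r * r + 2# ≈ 0#) (s⁴+3≈0 : s * s * s * s + 3# ≈ 0#)
           where

    a b c d Δ′ : Carrier
    a  = 2# * (1# - i)
    b  = r * (1# - i) * (1# - i * (s * s))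
    c  = - (2# * s * (1# - i * (s * s)))
    d  = 2# * r * s
    Δ′ = r * r * (s * s * s) * (1# + i) * (3# + i * (s * s))

    M : Mat4
    M = cubicMat a b c d

    module _ {n : ℕ} (i r s : Polynomial n) where

      aₚ bₚ cₚ dₚ Δₚ Δ′ₚ : Polynomial n
      aₚ  = κ 2 :* (κ 1 :- i)
      bₚ  = r :* (κ 1 :- i) :* (κ 1 :- i :* (s :* s))
      cₚ  = :- (κ 2 :* s :* (κ 1 :- i :* (s :* s)))
      dₚ  = κ 2 :* r :* s
      Δₚ  = aₚ :* dₚ :- bₚ :* cₚ
      Δ′ₚ = r :* r :* (s :* s :* s) :* (κ 1 :+ i) :* (κ 3 :+ i :* (s :* s))

      Mₚ : Fin 4 → Fin 4 → Polynomial n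
      Mₚ = cubicMatₚ aₚ bₚ cₚ dₚ

      modulo : Polynomial n → Polynomial n → Polynomial n → Polynomial n
      modulo p₁ p₂ p₃ = p₁ :* (i :* i :+ κ 1) :+ p₂ :* (r :* r :* r :+ κ 2) :+ p₃ :* (s :* s :* s :* s :+ κ 3)

    L₁ₚ L₂ₚ : ∀ {n} → Fin 4 → Polynomial n
    L₁ₚ = vecₚ (κ 1) (κ 0) (κ 0) (κ 1)
    L₂ₚ = vecₚ (κ 0) (κ 0) (κ 1) (κ 0)

    L₁M₂≈L₁M₀ : (L₁ ·M M) 2F ≈ (L₁ ·M M) 0F
    L₁M₂≈L₁M₀ = ≈-modulo₃ (solve 3 (λ i r s →
      (L₁ₚ ·Mₚ Mₚ i r s) 2F := (L₁ₚ ·Mₚ Mₚ i r s) 0F :+ modulo i r s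
        (:- κ 72 :+ κ 8 :* i :- κ 24 :* s :^ 2 :- κ 33 :* r :^ 3 :+ κ 24 :* i :* s :^ 2
         :- κ 17 :* i :* r :^ 3 :- κ 12 :* r :^ 3 :* s :^ 2 :+ κ 27 :* i :^ 2 :* r :^ 3
         :+ κ 15 :* i :* r :^ 3 :* s :^ 2 :- κ 9 :* i :^ 3 :* r :^ 3
         :+ κ 3 :* i :^ 2 :* r :^ 3 :* s :^ 2 :- κ 9 :* i :^ 3 :* r :^ 3 :* s :^ 2
         :+ κ 3 :* i :^ 4 :* r :^ 3 :* s :^ 2)
        (κ 32 :+ κ 32 :* i :+ κ 16 :* s :^ 2 :- κ 16 :* i :* s :^ 2)
        (:- κ 16 :* i :+ κ 16 :* i :^ 2 :- κ 4 :* i :* r :^ 3 :+ κ 8 :* i :^ 2 :* s :^ 2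
         :+ i :^ 2 :* r :^ 3 :- κ 8 :* i :^ 3 :* s :^ 2 :+ κ 9 :* i :^ 3 :* r :^ 3
         :- κ 9 :* i :^ 4 :* r :^ 3 :+ i :^ 3 :* r :^ 3 :* s :^ 2 :+ κ 3 :* i :^ 5 :* r :^ 3
         :- κ 3 :* i :^ 4 :* r :^ 3 :* s :^ 2 :+ κ 3 :* i :^ 5 :* r :^ 3 :* s :^ 2
         :- i :^ 6 :* r :^ 3 :* s :^ 2))
      refl i r s) i²+1≈0 r³+2≈0 s⁴+3≈0

    L₁M₃+3L₁M₁≈0 : (L₁ ·M M) 3F + 3# * (L₁ ·M M) 1F ≈ 0#
    L₁M₃+3L₁M₁≈0 = ≈-modulo₃ (solve 3 (λ i r s →
      (L₁ₚ ·Mₚ Mₚ i r s) 3F :+ κ 3 :* (L₁ₚ ·Mₚ Mₚ i r s) 1F := κ 0 :+ modulo i r s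
        (:- κ 24 :* s :- κ 48 :* s :^ 3 :+ κ 6 :* r :^ 3 :* s :+ κ 24 :* i :* s :^ 3
         :+ κ 24 :* r :^ 3 :* s :^ 3 :- κ 24 :* s :^ 7 :- κ 12 :* i :* r :^ 3 :* s :^ 3
         :- κ 12 :* i :* r :^ 3 :* s :^ 5 :+ κ 8 :* i :* s :^ 9 :+ κ 6 :* i :^ 2 :* r :^ 3 :* s :^ 5)
        (:- κ 12 :* i :* s :- κ 16 :* s :^ 3 :+ κ 12 :* i :* s :^ 5)
        (κ 24 :* i :* s :+ κ 24 :* s :^ 3 :- κ 8 :* i :* s :^ 5))
      refl i r s) i²+1≈0 r³+2≈0 s⁴+3≈0

    L₂M₂≈L₂M₀ : (L₂ ·M M) 2F ≈ (L₂ ·M M) 0F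
    L₂M₂≈L₂M₀ = ≈-modulo₃ (solve 3 (λ i r s →
      (L₂ₚ ·Mₚ Mₚ i r s) 2F := (L₂ₚ ·Mₚ Mₚ i r s) 0F :+ modulo i r s
        (:- κ 6 :* r :^ 2 :- κ 30 :* i :* r :^ 2 :+ κ 54 :* i :^ 2 :* r :^ 2
         :+ κ 12 :* i :* r :^ 2 :* s :^ 2 :- κ 18 :* i :^ 3 :* r :^ 2
         :- κ 12 :* i :^ 2 :* r :^ 2 :* s :^ 2)
        (κ 0)
        (κ 16 :* i :* r :^ 2 :- κ 22 :* i :^ 2 :* r :^ 2 :+ κ 18 :* i :^ 3 :* r :^ 2
         :- κ 8 :* i :^ 2 :* r :^ 2 :* s :^ 2 :- κ 18 :* i :^ 4 :* r :^ 2
         :+ κ 8 :* i :^ 3 :* r :^ 2 :* s :^ 2 :+ κ 6 :* i :^ 5 :* r :^ 2))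
      refl i r s) i²+1≈0 r³+2≈0 s⁴+3≈0

    L₂M₃+3L₂M₁≈0 : (L₂ ·M M) 3F + 3# * (L₂ ·M M) 1F ≈ 0#
    L₂M₃+3L₂M₁≈0 = ≈-modulo₃ (solve 3 (λ i r s →
      (L₂ₚ ·Mₚ Mₚ i r s) 3F :+ κ 3 :* (L₂ₚ ·Mₚ Mₚ i r s) 1F := κ 0 :+ modulo i r s
        (κ 18 :* r :^ 2 :* s :+ κ 12 :* r :^ 2 :* s :^ 3 :- κ 6 :* i :* r :^ 2 :* s :^ 3
         :+ κ 36 :* i :* r :^ 2 :* s :^ 5 :+ κ 12 :* r :^ 2 :* s :^ 7
         :- κ 18 :* i :^ 2 :* r :^ 2 :* s :^ 5 :- κ 12 :* i :^ 2 :* r :^ 2 :* s :^ 7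
         :+ κ 6 :* i :^ 3 :* r :^ 2 :* s :^ 7)
        (κ 0)
        (:- κ 12 :* i :* r :^ 2 :* s :- κ 12 :* r :^ 2 :* s :^ 3))
      refl i r s) i²+1≈0 r³+2≈0 s⁴+3≈0

    Δ·Δ′≈2⁵3² : (a * d - b * c) * Δ′ ≈ 2# * 2# * 2# * 2# * 2# * (3# * 3#)
    Δ·Δ′≈2⁵3² = ≈-modulo₃ (solve 3 (λ i r s →
      Δₚ i r s :* Δ′ₚ i r s := κ 2 :* κ 2 :* κ 2 :* κ 2 :* κ 2 :* (κ 3 :* κ 3) :+ modulo i r s
        (:- κ 18 :* r :^ 3 :* s :^ 4 :+ κ 6 :* i :* r :^ 3 :* s :^ 6 :+ κ 4 :* r :^ 3 :* s :^ 8
         :- κ 2 :* i :^ 2 :* r :^ 3 :* s :^ 8 :+ κ 4 :* i :* r :^ 3 :* s :^ 10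
         :- κ 2 :* i :^ 3 :* r :^ 3 :* s :^ 10)
        (:- κ 144)
        (κ 48 :* r :^ 3 :- κ 4 :* r :^ 3 :* s :^ 4 :- κ 4 :* i :* r :^ 3 :* s :^ 6))
      refl i r s) i²+1≈0 r³+2≈0 s⁴+3≈0

    module _ (2≉0 : ¬ 2# ≈ 0#) (3≉0 : ¬ 3# ≈ 0#) where

      Δ≉0 : ¬ (a * d - b * c ≈ 0#)
      Δ≉0 Δ≈0 = 2⁵3²≉0 (trans (sym Δ·Δ′≈2⁵3²) (trans (*-congʳ Δ≈0) (zeroˡ Δ′)))
        where
        2⁵3²≉0 : ¬ 2# * 2# * 2# * 2# * 2# * (3# * 3#) ≈ 0#
        2⁵3²≉0 = *-nonzero (*-nonzero (*-nonzero (*-nonzero (*-nonzero 2≉0 2≉0) 2≉0) 2≉0) 2≉0)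
                           (*-nonzero 3≉0 3≉0)

      L≃ℓ : SameOrbit L₁ L₂ ℓ₁ ℓ₂
      L≃ℓ = a , b , c , d , Δ≉0 , maps-self-polar-line Δ≉0 (L-self-polar 3≉0) (ℓ-isotropic 3≉0)
              (on-ℓ 3≉0 _ L₁M₂≈L₁M₀ L₁M₃+3L₁M₁≈0) (on-ℓ 3≉0 _ L₂M₂≈L₂M₀ L₂M₃+3L₂M₁≈0)

lemma7p5 : (q : ℕ) → (F : FiniteField q) → q % 12 ≡ 1 →
    let open FiniteField F
        open Geometry F
    in (∃ λ x → x * x * x ≈ - (2# ⁻¹)) →
       (∃ λ y → y * y * y * y ≈ - (3# ⁻¹)) →
       (∃ λ z → z * z ≈ - (3# ⁻¹))
       × SameOrbit (vec 1# 0# 0# 1#) (vec 0# 0# 1# 0#)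
                   (vec 0# (- (3# ⁻¹)) 0# 1#) (vec 1# 0# 1# 0#)
lemma7p5 q F q%12≡1 (x , x³≈-½) (y , y⁴≈-⅓) =
  (y * y , y²y²≈-⅓) ,
  L≃ℓ (proj₁ (√-1 q%12≡1)) (- (2# * (x * x))) (3# * (y * y * y))
      (trans (+-congʳ (proj₂ (√-1 q%12≡1))) (-‿inverseˡ 1#))
      (x³≈-½⇒[-2x²]³≈-2 (2≉0 q%12≡1) x³≈-½)
      (y⁴≈-⅓⇒[3y³]⁴≈-3 (3≉0 q%12≡1) y⁴≈-⅓)
      (2≉0 q%12≡1) (3≉0 q%12≡1)
  where
  open FiniteField F hiding (zero)
  open Geometry F
  open IntegerCoefficientSolver commRing
  open FiniteFieldFacts F using (2≉0; 3≉0; √-1; x³≈-½⇒[-2x²]³≈-2; y⁴≈-⅓⇒[3y³]⁴≈-3)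
  open LineOrbit F using (L≃ℓ)

  y²y²≈-⅓ : y * y * (y * y) ≈ - (3# ⁻¹)
  y²y²≈-⅓ = trans (solve 1 (λ y → y :* y :* (y :* y) := y :* y :* y :* y) refl y) y⁴≈-⅓
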